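{- Let $p$ be a prime, $r\ge1$, $G=\mathbb{Z}_{p^r}$, $H$ any finite abelian group and $k\ge1$. Then \[\gamma_k(G,H)=|\mathrm{Hom}(\mathbb{Z}_{p^r},H)|+(1-p^{ -k})\sum_{a=1}^r p^{ak}\,|\mathrm{Hom}(\mathbb{Z}_{p^{r-a}},H)|.\]
   Context: For finite groups $G,H$ with $H$ abelian and $\vec x\in G^k$, $\Gamma_{\vec x}:\mathrm{Hom}(G,H)\to H^k$ is $\varphi\mapsto(\varphi(x_1),\dots,\varphi(x_k))$, and $\gamma_k(G,H)=\sum_{\vec x\in G^k}|\ker\Gamma_{\vec x}|$ (equivalently $\sum_{\varphi\in\mathrm{Hom}(G,H)}|\ker\varphi|^k$). $\mathbb{Z}_{p^0}$ denotes the trivial group. -}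

module Defs where

open import Level using (0ℓ)
open import Data.Nat using (ℕ; zero; suc; _+_; _*_; _∸_; _^_)
open import Data.Nat.DivMod using (_mod_)
open import Data.Fin using (Fin; toℕ)
open import Data.Fin.Properties using (all?; _≟_)
open import Data.Vec using (Vec; []; _∷_; lookup)
open import Data.List using (List; []; _∷_; [_]; map; concatMap; allFin; filter; length; applyUpTo)
open import Data.Nat.ListAction using (sum)
open import Relation.Binary.PropositionalEquality using (_≡_)
open import Relation.Nullary using (Dec)
open import Algebra.Structures using (IsAbelianGroup)

record FinAbGroup : Set where
  field
    size : ℕ
    _∙_  : Fin size → Fin size → Fin size
    ε    : Fin size
    _⁻¹  : Fin size → Fin size
    isAbelianGroup : IsAbelianGroup _≡_ _∙_ ε _⁻¹

addMod : (m : ℕ) → Fin m → Fin m → Fin m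
addMod (suc n) a b = (toℕ a + toℕ b) mod (suc n)

-- all functions Fin m → A, as vectors (tables)
allVecs : (m n : ℕ) → List (Vec (Fin n) m)
allVecs zero    n = [ [] ]
allVecs (suc m) n = concatMap (λ v → map (_∷ v) (allFin n)) (allVecs m n)

module _ (H : FinAbGroup) where
  open FinAbGroup H

  IsHom : (m : ℕ) → Vec (Fin size) m → Set
  IsHom m f = ∀ a b → lookup f (addMod m a b) ≡ (lookup f a ∙ lookup f b)

  isHom? : (m : ℕ) (f : Vec (Fin size) m) → Dec (IsHom m f)
  isHom? m f = all? (λ a → all? (λ b → lookup f (addMod m a b) ≟ (lookup f a ∙ lookup f b)))

  Homs : (m : ℕ) → List (Vec (Fin size) m)
  Homs m = filter (isHom? m) (allVecs m size)

  homCount : ℕ → ℕ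
  homCount m = length (Homs m)

  InKer : (m k : ℕ) → Vec (Fin m) k → Vec (Fin size) m → Set
  InKer m k x φ = ∀ i → lookup φ (lookup x i) ≡ ε

  inKer? : (m k : ℕ) (x : Vec (Fin m) k) (φ : Vec (Fin size) m) → Dec (InKer m k x φ)
  inKer? m k x φ = all? (λ i → lookup φ (lookup x i) ≟ ε)

  kerCount : (m k : ℕ) → Vec (Fin m) k → ℕ
  kerCount m k x = length (filter (inKer? m k x) (Homs m))

  gamma : (k m : ℕ) → ℕ
  gamma k m = sum (map (kerCount m k) (allVecs k m))

-- Counting the pairs (x, φ) with φ(x_1) = ⋯ = φ(x_k) = 0 by φ first gives γ_k = Σ_φ |ker φ|^k.
-- Evaluation at 1 identifies Hom(ℤ_N, H) with {h ∈ H ∣ N·h = 0}, h corresponding to t ↦ t·h,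
-- whose kernel is {t < N ∣ t·h = 0}. For N = p^r such an h has order p^c with c ≤ r, so this
-- kernel has p^(r−c) elements, and p^j·h = 0 exactly when c ≤ j. With X = p^k, the contribution
-- of h to the two sides is therefore X·X^(r−c) and X + (X − 1)(X + X² + ⋯ + X^(r−c)), which
-- agree by the geometric series.

module Submission where

open import Defs
open import Data.Bool.Base using (if_then_else_)
open import Data.Nat
  using (ℕ; zero; suc; NonZero; _+_; _*_; _∸_; _^_; _≤_; _<_; z≤n; s≤s; s≤s⁻¹; _≤?_; _<?_; nonTrivial⇒n>1)
open import Data.Nat.Properties
open import Data.Nat.ListAction using (sum)
open import Data.Nat.ListAction.Properties using (sum-++)
open import Data.Fin using (Fin; toℕ) renaming (zero to fzero; suc to fsuc)
open import Data.List
  using (List; []; _∷_; [_]; _++_; map; concatMap; allFin; filter; length; applyUpTo; upTo; tabulate)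
open import Data.List.Properties using (map-cong; map-∘; map-++; map-upTo; applyUpTo-∷ʳ; map-tabulate)
open import Data.Product using (_×_; _,_; ∃-syntax)
open import Data.Sum using (inj₁; inj₂)
open import Data.Nat.Divisibility
  using (_∣_; divides; _∣?_; _∣0; ∣-refl; ∣⇒≤; ∣1⇒≡1; ∣m+n∣m⇒∣n; ∣m∣n⇒∣m+n; *-cancelʳ-∣; m%n≡0⇒n∣m)
open import Data.Nat.Coprimality using (Coprime; coprime-divisor)
open import Data.Nat.Primality using (Prime; prime⇒nonZero; prime⇒nonTrivial; prime⇒irreducible)
open import Function using (_∘_)
open import Level using (_⊔_; 0ℓ)
open import Relation.Binary.PropositionalEquality
  using (_≡_; refl; sym; trans; cong; cong₂; subst; module ≡-Reasoning)
open import Relation.Nullary using (Dec; yes; no; ¬_; does; _×-dec_; contradiction)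
open import Relation.Unary using (Decidable)
open import Relation.Binary.Definitions using (DecidableEquality)
import Data.Fin.Properties as Fin
open import Data.Vec using (Vec; []; _∷_; lookup)
import Data.Vec as Vec
open import Data.Vec.Properties using (∷-injective; lookup∘tabulate; tabulate∘lookup; tabulate-cong)
  renaming (≡-dec to ≡-decᵥ)
open import Data.Nat.DivMod using (_mod_; _%_; _/_; m%n<n; m≡m%n+[m/n]*n; m<n⇒m%n≡m; n%n≡0; %-distribˡ-+)
open import Algebra.Bundles using (AbelianGroup)
import Algebra.Properties.Monoid.Mult as MonoidMult
import Algebra.Properties.Group as GroupProperties
open import Algebra.Properties.CommutativeSemigroup +-commutativeSemigroup using (interchange)

-- Indicators and finite sums

𝟙 : ∀ {ℓ} {P : Set ℓ} → Dec P → ℕ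
𝟙 d = if does d then 1 else 0

module _ {ℓ} {P : Set ℓ} where

  𝟙-yes : (d : Dec P) → P → 𝟙 d ≡ 1
  𝟙-yes (yes _) _ = refl
  𝟙-yes (no ¬p) p = contradiction p ¬p

  𝟙-no : (d : Dec P) → ¬ P → 𝟙 d ≡ 0
  𝟙-no (yes p) ¬p = contradiction p ¬p
  𝟙-no (no _)  _  = refl

module _ {ℓ ℓ′} {P : Set ℓ} {Q : Set ℓ′} where

  𝟙-⇔ : (d : Dec P) (e : Dec Q) → (P → Q) → (Q → P) → 𝟙 d ≡ 𝟙 e
  𝟙-⇔ (yes p) (yes _) _  _    = refl
  𝟙-⇔ (yes p) (no ¬q) to _    = contradiction (to p) ¬q
  𝟙-⇔ (no ¬p) (yes q) _  from = contradiction (from q) ¬p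
  𝟙-⇔ (no _)  (no _)  _  _    = refl

  𝟙-×-dec : (d : Dec P) (e : Dec Q) → 𝟙 (d ×-dec e) ≡ 𝟙 d * 𝟙 e
  𝟙-×-dec (yes _) (yes _) = refl
  𝟙-×-dec (yes _) (no _)  = refl
  𝟙-×-dec (no _)  _       = refl

sumOver : ∀ {a} {A : Set a} → List A → (A → ℕ) → ℕ
sumOver xs f = sum (map f xs)

syntax sumOver xs (λ x → e) = ∑[ x ∈ xs ] e

module _ {a} {A : Set a} where

  sumOver-cong : ∀ xs {f g : A → ℕ} → (∀ x → f x ≡ g x) → sumOver xs f ≡ sumOver xs g
  sumOver-cong xs f≗g = cong sum (map-cong f≗g xs)

  sumOver-zero : ∀ (xs : List A) → ∑[ x ∈ xs ] 0 ≡ 0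
  sumOver-zero []       = refl
  sumOver-zero (_ ∷ xs) = sumOver-zero xs

  sumOver-distrib-+ : ∀ xs (f g : A → ℕ) → ∑[ x ∈ xs ] (f x + g x) ≡ sumOver xs f + sumOver xs g
  sumOver-distrib-+ []       f g = refl
  sumOver-distrib-+ (x ∷ xs) f g = begin
    f x + g x + ∑[ x ∈ xs ] (f x + g x)     ≡⟨ cong (f x + g x +_) (sumOver-distrib-+ xs f g) ⟩
    f x + g x + (sumOver xs f + sumOver xs g) ≡⟨ interchange (f x) (g x) _ _ ⟩
    f x + sumOver xs f + (g x + sumOver xs g) ∎
    where open ≡-Reasoning

  *-distribˡ-sumOver : ∀ c xs (f : A → ℕ) → c * sumOver xs f ≡ ∑[ x ∈ xs ] (c * f x)
  *-distribˡ-sumOver c []       f = *-zeroʳ c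
  *-distribˡ-sumOver c (x ∷ xs) f =
    trans (*-distribˡ-+ c (f x) _) (cong (c * f x +_) (*-distribˡ-sumOver c xs f))

  *-distribʳ-sumOver : ∀ c xs (f : A → ℕ) → sumOver xs f * c ≡ ∑[ x ∈ xs ] (f x * c)
  *-distribʳ-sumOver c xs f =
    trans (*-comm _ c) (trans (*-distribˡ-sumOver c xs f) (sumOver-cong xs (λ x → *-comm c (f x))))

  sumOver-++ : ∀ xs ys (f : A → ℕ) → sumOver (xs ++ ys) f ≡ sumOver xs f + sumOver ys f
  sumOver-++ xs ys f = trans (cong sum (map-++ f xs ys)) (sum-++ (map f xs) (map f ys))

  sumOver-filter : ∀ {p} {P : A → Set p} (P? : Decidable P) xs (f : A → ℕ) →
                   sumOver (filter P? xs) f ≡ ∑[ x ∈ xs ] (𝟙 (P? x) * f x)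
  sumOver-filter P? []       f = refl
  sumOver-filter P? (x ∷ xs) f with P? x
  ... | yes _ = cong₂ _+_ (sym (+-identityʳ (f x))) (sumOver-filter P? xs f)
  ... | no _  = sumOver-filter P? xs f

  length-filter : ∀ {p} {P : A → Set p} (P? : Decidable P) xs →
                  length (filter P? xs) ≡ ∑[ x ∈ xs ] 𝟙 (P? x)
  length-filter P? []       = refl
  length-filter P? (x ∷ xs) with P? x
  ... | yes _ = cong suc (length-filter P? xs)
  ... | no _  = length-filter P? xs

module _ {a b} {A : Set a} {B : Set b} where

  sumOver-map : ∀ (g : A → B) xs (f : B → ℕ) → sumOver (map g xs) f ≡ ∑[ x ∈ xs ] f (g x)
  sumOver-map g xs f = cong sum (sym (map-∘ xs))

  sumOver-concatMap : ∀ (g : A → List B) xs (f : B → ℕ) →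
                      sumOver (concatMap g xs) f ≡ ∑[ x ∈ xs ] sumOver (g x) f
  sumOver-concatMap g []       f = refl
  sumOver-concatMap g (x ∷ xs) f =
    trans (sumOver-++ (g x) _ f) (cong (sumOver (g x) f +_) (sumOver-concatMap g xs f))

  sumOver-comm : ∀ xs ys (f : A → B → ℕ) →
                 ∑[ x ∈ xs ] ∑[ y ∈ ys ] f x y ≡ ∑[ y ∈ ys ] ∑[ x ∈ xs ] f x y
  sumOver-comm []       ys f = sym (sumOver-zero ys)
  sumOver-comm (x ∷ xs) ys f = trans (cong (sumOver ys (f x) +_) (sumOver-comm xs ys f))
                                     (sym (sumOver-distrib-+ ys (f x) _))

sumOver-allFin-toℕ : ∀ n (F : ℕ → ℕ) → ∑[ a ∈ allFin n ] F (toℕ a) ≡ sum (applyUpTo F n)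
sumOver-allFin-toℕ n F = cong sum (trans (map-tabulate (λ a → a) (F ∘ toℕ)) (tabulate-toℕ n F))
  where
  tabulate-toℕ : ∀ n (F : ℕ → ℕ) → tabulate {n = n} (F ∘ toℕ) ≡ applyUpTo F n
  tabulate-toℕ zero    F = refl
  tabulate-toℕ (suc n) F = cong (F 0 ∷_) (tabulate-toℕ n (F ∘ suc))

sum-applyUpTo≡sumOver-upTo : ∀ n (F : ℕ → ℕ) → sum (applyUpTo F n) ≡ sumOver (upTo n) F
sum-applyUpTo≡sumOver-upTo n F = cong sum (sym (map-upTo F n))

sumOver-sum-applyUpTo-comm : ∀ {a} {A : Set a} (xs : List A) n (f : ℕ → A → ℕ) →
  ∑[ x ∈ xs ] sum (applyUpTo (λ i → f i x) n) ≡ sum (applyUpTo (λ i → sumOver xs (f i)) n)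
sumOver-sum-applyUpTo-comm xs n f = begin
  ∑[ x ∈ xs ] sum (applyUpTo (λ i → f i x) n)   ≡⟨ sumOver-cong xs (λ x → sum-applyUpTo≡sumOver-upTo n (λ i → f i x)) ⟩
  ∑[ x ∈ xs ] ∑[ i ∈ upTo n ] f i x             ≡⟨ sumOver-comm xs (upTo n) (λ x i → f i x) ⟩
  ∑[ i ∈ upTo n ] sumOver xs (f i)              ≡⟨ sum-applyUpTo≡sumOver-upTo n (λ i → sumOver xs (f i)) ⟨
  sum (applyUpTo (λ i → sumOver xs (f i)) n)    ∎
  where open ≡-Reasoning

sumOver-affine : ∀ {a} {A : Set a} (xs : List A) X Y (f : A → ℕ) n (g : ℕ → A → ℕ) →
  ∑[ x ∈ xs ] (X * f x + Y * sum (applyUpTo (λ i → g i x) n))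
    ≡ X * sumOver xs f + Y * sum (applyUpTo (λ i → sumOver xs (g i)) n)
sumOver-affine xs X Y f n g = begin
  ∑[ x ∈ xs ] (X * f x + Y * sum (applyUpTo (λ i → g i x) n))
    ≡⟨ sumOver-distrib-+ xs _ _ ⟩
  ∑[ x ∈ xs ] (X * f x) + ∑[ x ∈ xs ] (Y * sum (applyUpTo (λ i → g i x) n))
    ≡⟨ cong₂ _+_ (*-distribˡ-sumOver X xs f) (*-distribˡ-sumOver Y xs _) ⟨
  X * sumOver xs f + Y * ∑[ x ∈ xs ] sum (applyUpTo (λ i → g i x) n)
    ≡⟨ cong (λ z → X * sumOver xs f + Y * z) (sumOver-sum-applyUpTo-comm xs n g) ⟩
  X * sumOver xs f + Y * sum (applyUpTo (λ i → sumOver xs (g i)) n) ∎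
  where open ≡-Reasoning

sum-applyUpTo-cong : ∀ n {F G : ℕ → ℕ} → (∀ i → i < n → F i ≡ G i) →
                     sum (applyUpTo F n) ≡ sum (applyUpTo G n)
sum-applyUpTo-cong zero    F≗G = refl
sum-applyUpTo-cong (suc n) F≗G =
  cong₂ _+_ (F≗G 0 (s≤s z≤n)) (sum-applyUpTo-cong n (λ i i<n → F≗G (suc i) (s≤s i<n)))

sum-applyUpTo-+ : ∀ m n (F : ℕ → ℕ) →
                  sum (applyUpTo F (m + n)) ≡ sum (applyUpTo F m) + sum (applyUpTo (λ i → F (m + i)) n)
sum-applyUpTo-+ zero    n F = refl
sum-applyUpTo-+ (suc m) n F =
  trans (cong (F 0 +_) (sum-applyUpTo-+ m n (F ∘ suc))) (sym (+-assoc (F 0) _ _))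

sum-applyUpTo-suc : ∀ n (F : ℕ → ℕ) → sum (applyUpTo F (suc n)) ≡ sum (applyUpTo F n) + F n
sum-applyUpTo-suc n F = begin
  sum (applyUpTo F (suc n))             ≡⟨ cong sum (sym (applyUpTo-∷ʳ F n)) ⟩
  sum (applyUpTo F n ++ [ F n ])        ≡⟨ sum-++ (applyUpTo F n) [ F n ] ⟩
  sum (applyUpTo F n) + (F n + 0)       ≡⟨ cong (sum (applyUpTo F n) +_) (+-identityʳ (F n)) ⟩
  sum (applyUpTo F n) + F n             ∎
  where open ≡-Reasoning

sum-applyUpTo-zero : ∀ n {F : ℕ → ℕ} → (∀ i → i < n → F i ≡ 0) → sum (applyUpTo F n) ≡ 0
sum-applyUpTo-zero zero    F≡0 = refl
sum-applyUpTo-zero (suc n) F≡0 =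
  cong₂ _+_ (F≡0 0 (s≤s z≤n)) (sum-applyUpTo-zero n (λ i i<n → F≡0 (suc i) (s≤s i<n)))

sum-applyUpTo-restrict : ∀ {m n} → m ≤ n → (F : ℕ → ℕ) →
                         sum (applyUpTo (λ i → F i * 𝟙 (i <? m)) n) ≡ sum (applyUpTo F m)
sum-applyUpTo-restrict {zero} {n} _ F =
  sum-applyUpTo-zero n (λ i _ → *-zeroʳ (F i))
sum-applyUpTo-restrict {suc m} {suc n} (s≤s m≤n) F = cong₂ _+_ (*-identityʳ (F 0)) (begin
  sum (applyUpTo (λ i → F (suc i) * 𝟙 (suc i <? suc m)) n)
    ≡⟨ sum-applyUpTo-cong n (λ i _ → cong (F (suc i) *_) (𝟙-⇔ (suc i <? suc m) (i <? m) s≤s⁻¹ s≤s)) ⟩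
  sum (applyUpTo (λ i → F (suc i) * 𝟙 (i <? m)) n)
    ≡⟨ sum-applyUpTo-restrict m≤n (F ∘ suc) ⟩
  sum (applyUpTo (F ∘ suc) m) ∎)
  where open ≡-Reasoning

-- Enumerations and reindexing

record Enumerates {a} {A : Set a} (_≟_ : DecidableEquality A) (xs : List A) : Set a where
  constructor enumerates
  field occurs-once : ∀ a → ∑[ x ∈ xs ] 𝟙 (x ≟ a) ≡ 1

open Enumerates

sumOver-select : ∀ {a} {A : Set a} {_≟_ : DecidableEquality A} {xs} → Enumerates _≟_ xs →
                 ∀ a (f : A → ℕ) → ∑[ x ∈ xs ] (𝟙 (x ≟ a) * f x) ≡ f a
sumOver-select {_≟_ = _≟_} {xs} enum a f = begin
  ∑[ x ∈ xs ] (𝟙 (x ≟ a) * f x)   ≡⟨ sumOver-cong xs only-a ⟩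
  ∑[ x ∈ xs ] (𝟙 (x ≟ a) * f a)   ≡⟨ *-distribʳ-sumOver (f a) xs _ ⟨
  (∑[ x ∈ xs ] 𝟙 (x ≟ a)) * f a   ≡⟨ cong (_* f a) (occurs-once enum a) ⟩
  1 * f a                          ≡⟨ *-identityˡ (f a) ⟩
  f a                              ∎
  where
  open ≡-Reasoning
  only-a : ∀ x → 𝟙 (x ≟ a) * f x ≡ 𝟙 (x ≟ a) * f a
  only-a x with x ≟ a
  ... | yes refl = refl
  ... | no _     = refl

sumOver-allFin-suc : ∀ n (f : Fin (suc n) → ℕ) →
                     sumOver (allFin (suc n)) f ≡ f fzero + ∑[ b ∈ allFin n ] f (fsuc b)
sumOver-allFin-suc n f =
  cong (f fzero +_) (trans (cong (λ bs → sumOver bs f) (sym (map-tabulate (λ b → b) fsuc)))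
                           (sumOver-map fsuc (allFin n) f))

allFin-enumerates : ∀ n → Enumerates Fin._≟_ (allFin n)
allFin-enumerates n = enumerates (once n)
  where
  once : ∀ n (a : Fin n) → ∑[ b ∈ allFin n ] 𝟙 (b Fin.≟ a) ≡ 1
  once (suc n) fzero = trans (sumOver-allFin-suc n (λ b → 𝟙 (b Fin.≟ fzero)))
    (cong suc (trans (sumOver-cong (allFin n) (λ b → 𝟙-no (fsuc b Fin.≟ fzero) (λ ())))
                     (sumOver-zero (allFin n))))
  once (suc n) (fsuc a) = trans (sumOver-allFin-suc n (λ b → 𝟙 (b Fin.≟ fsuc a)))
    (trans (sumOver-cong (allFin n) (λ b → 𝟙-⇔ (fsuc b Fin.≟ fsuc a) (b Fin.≟ a) Fin.suc-injective (cong fsuc)))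
           (once n a))

sumOver-allVecs-suc : ∀ m n (f : Vec (Fin n) (suc m) → ℕ) →
                      sumOver (allVecs (suc m) n) f ≡ ∑[ v ∈ allVecs m n ] ∑[ c ∈ allFin n ] f (c ∷ v)
sumOver-allVecs-suc m n f = trans (sumOver-concatMap _ (allVecs m n) f)
                                  (sumOver-cong (allVecs m n) (λ v → sumOver-map (_∷ v) (allFin n) f))

sumOver-allVecs-all : ∀ {n p} {P : Fin n → Set p} (P? : Decidable P) k →
                      ∑[ x ∈ allVecs k n ] 𝟙 (Fin.all? (λ i → P? (lookup x i))) ≡ (∑[ a ∈ allFin n ] 𝟙 (P? a)) ^ k
sumOver-allVecs-all P? zero = refl
sumOver-allVecs-all {n} {P = P} P? (suc k) = begin
  ∑[ x ∈ allVecs (suc k) n ] 𝟙 (all-P? x)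
    ≡⟨ sumOver-allVecs-suc k n _ ⟩
  ∑[ v ∈ allVecs k n ] ∑[ c ∈ allFin n ] 𝟙 (all-P? (c ∷ v))
    ≡⟨ sumOver-cong (allVecs k n) (λ v → sumOver-cong (allFin n) (λ c → split-head c v)) ⟩
  ∑[ v ∈ allVecs k n ] ∑[ c ∈ allFin n ] (𝟙 (P? c) * 𝟙 (all-P? v))
    ≡⟨ sumOver-cong (allVecs k n) (λ v → *-distribʳ-sumOver _ (allFin n) _) ⟨
  ∑[ v ∈ allVecs k n ] (K * 𝟙 (all-P? v))
    ≡⟨ *-distribˡ-sumOver K (allVecs k n) _ ⟨
  K * ∑[ v ∈ allVecs k n ] 𝟙 (all-P? v)
    ≡⟨ cong (K *_) (sumOver-allVecs-all P? k) ⟩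
  K * K ^ k ∎
  where
  open ≡-Reasoning
  K = ∑[ a ∈ allFin n ] 𝟙 (P? a)
  all-P? : ∀ {m} (x : Vec (Fin n) m) → Dec (∀ i → P (lookup x i))
  all-P? x = Fin.all? (λ i → P? (lookup x i))
  split-head : ∀ {m} c (v : Vec (Fin n) m) → 𝟙 (all-P? (c ∷ v)) ≡ 𝟙 (P? c) * 𝟙 (all-P? v)
  split-head c v = trans (𝟙-⇔ (all-P? (c ∷ v)) (P? c ×-dec all-P? v)
                              (λ all → all fzero , all ∘ fsuc)
                              (λ { (pc , _) fzero → pc ; (_ , all) (fsuc i) → all i }))
                         (𝟙-×-dec (P? c) (all-P? v))

allVecs-enumerates : ∀ m n → Enumerates (≡-decᵥ Fin._≟_) (allVecs m n)
allVecs-enumerates m n = enumerates (once m)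
  where
  infix 4 _≟ᵥ_
  _≟ᵥ_ : ∀ {k} → DecidableEquality (Vec (Fin n) k)
  _≟ᵥ_ = ≡-decᵥ Fin._≟_

  split-head : ∀ {k} c b (v w : Vec (Fin n) k) → 𝟙 (c ∷ v ≟ᵥ b ∷ w) ≡ 𝟙 (c Fin.≟ b) * 𝟙 (v ≟ᵥ w)
  split-head c b v w = trans (𝟙-⇔ (c ∷ v ≟ᵥ b ∷ w) ((c Fin.≟ b) ×-dec (v ≟ᵥ w))
                                  ∷-injective (λ (c≡b , v≡w) → cong₂ _∷_ c≡b v≡w))
                             (𝟙-×-dec (c Fin.≟ b) (v ≟ᵥ w))

  once : ∀ m (w : Vec (Fin n) m) → ∑[ v ∈ allVecs m n ] 𝟙 (v ≟ᵥ w) ≡ 1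
  once zero    []      = refl
  once (suc m) (b ∷ w) = begin
    ∑[ v ∈ allVecs (suc m) n ] 𝟙 (v ≟ᵥ b ∷ w)
      ≡⟨ sumOver-allVecs-suc m n _ ⟩
    ∑[ v ∈ allVecs m n ] ∑[ c ∈ allFin n ] 𝟙 (c ∷ v ≟ᵥ b ∷ w)
      ≡⟨ sumOver-cong (allVecs m n) (λ v → sumOver-cong (allFin n) (λ c → split-head c b v w)) ⟩
    ∑[ v ∈ allVecs m n ] ∑[ c ∈ allFin n ] (𝟙 (c Fin.≟ b) * 𝟙 (v ≟ᵥ w))
      ≡⟨ sumOver-cong (allVecs m n) (λ v → sumOver-select (allFin-enumerates n) b _) ⟩
    ∑[ v ∈ allVecs m n ] 𝟙 (v ≟ᵥ w)
      ≡⟨ once m w ⟩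
    1 ∎
    where open ≡-Reasoning

record PartialInverse {a b p q} {A : Set a} {B : Set b} (P : A → Set p) (Q : B → Set q)
                      : Set (a ⊔ b ⊔ p ⊔ q) where
  field
    to          : A → B
    from        : B → A
    to-closed   : ∀ {x} → P x → Q (to x)
    from-closed : ∀ {y} → Q y → P (from y)
    from∘to     : ∀ {x} → P x → from (to x) ≡ x
    to∘from     : ∀ {y} → Q y → to (from y) ≡ y

sumOver-reindex : ∀ {a b p q} {A : Set a} {B : Set b} {P : A → Set p} {Q : B → Set q}
                  {_≟ᴬ_ : DecidableEquality A} {_≟ᴮ_ : DecidableEquality B} {xs ys} →
                  Enumerates _≟ᴬ_ xs → Enumerates _≟ᴮ_ ys →
                  (P? : Decidable P) (Q? : Decidable Q) (π : PartialInverse P Q) → let open PartialInverse π in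
                  ∀ (w : A → ℕ) → ∑[ x ∈ xs ] (𝟙 (P? x) * w x) ≡ ∑[ y ∈ ys ] (𝟙 (Q? y) * w (from y))
sumOver-reindex {P = P} {Q} {_≟ᴬ_} {_≟ᴮ_} {xs} {ys} enumA enumB P? Q? π w = begin
  ∑[ x ∈ xs ] (𝟙 (P? x) * w x)
    ≡⟨ sumOver-cong xs spread ⟩
  ∑[ x ∈ xs ] ∑[ y ∈ ys ] (𝟙 (P? x ×-dec (y ≟ᴮ to x)) * w (from y))
    ≡⟨ sumOver-comm xs ys _ ⟩
  ∑[ y ∈ ys ] ∑[ x ∈ xs ] (𝟙 (P? x ×-dec (y ≟ᴮ to x)) * w (from y))
    ≡⟨ sumOver-cong ys (λ y → trans (sym (*-distribʳ-sumOver (w (from y)) xs _)) (cong (_* w (from y)) (fibre y))) ⟩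
  ∑[ y ∈ ys ] (𝟙 (Q? y) * w (from y)) ∎
  where
  open ≡-Reasoning
  open PartialInverse π
  spread : ∀ x → 𝟙 (P? x) * w x ≡ ∑[ y ∈ ys ] (𝟙 (P? x ×-dec (y ≟ᴮ to x)) * w (from y))
  spread x with P? x
  ... | yes px = sym (trans (sumOver-select enumB (to x) (w ∘ from))
                            (trans (cong w (from∘to px)) (sym (+-identityʳ (w x)))))
  ... | no _   = sym (sumOver-zero ys)
  fibre : ∀ y → ∑[ x ∈ xs ] 𝟙 (P? x ×-dec (y ≟ᴮ to x)) ≡ 𝟙 (Q? y)
  fibre y with Q? y
  ... | yes qy = trans (sumOver-cong xs (λ x → 𝟙-⇔ (P? x ×-dec (y ≟ᴮ to x)) (x ≟ᴬ from y)
                         (λ (px , y≡tx) → trans (sym (from∘to px)) (cong from (sym y≡tx)))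
                         (λ { refl → from-closed qy , sym (to∘from qy) })))
                       (occurs-once enumA (from y))
  ... | no ¬qy = trans (sumOver-cong xs (λ x → 𝟙-no (P? x ×-dec (y ≟ᴮ to x))
                         (λ (px , y≡tx) → ¬qy (subst Q (sym y≡tx) (to-closed px)))))
                       (sumOver-zero xs)

-- Elementary number theory

geometric-sum : ∀ {X} → 1 ≤ X → ∀ m → X * X ^ m ≡ X + (X ∸ 1) * sum (applyUpTo (λ i → X ^ suc i) m)
geometric-sum {X} 1≤X zero    =
  trans (*-identityʳ X) (sym (trans (cong (X +_) (*-zeroʳ (X ∸ 1))) (+-identityʳ X)))
geometric-sum {X} 1≤X (suc m) = sym (begin
  X + (X ∸ 1) * S (suc m)                       ≡⟨ cong (λ z → X + (X ∸ 1) * z) (sum-applyUpTo-suc m (λ i → X ^ suc i)) ⟩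
  X + (X ∸ 1) * (S m + X ^ suc m)               ≡⟨ cong (X +_) (*-distribˡ-+ (X ∸ 1) (S m) _) ⟩
  X + ((X ∸ 1) * S m + (X ∸ 1) * X ^ suc m)     ≡⟨ +-assoc X _ _ ⟨
  X + (X ∸ 1) * S m + (X ∸ 1) * X ^ suc m       ≡⟨ cong (_+ (X ∸ 1) * X ^ suc m) (geometric-sum 1≤X m) ⟨
  X ^ suc m + (X ∸ 1) * X ^ suc m               ≡⟨⟩
  (1 + (X ∸ 1)) * X ^ suc m                     ≡⟨ cong (_* X ^ suc m) (m+[n∸m]≡n 1≤X) ⟩
  X * X ^ suc m                                 ∎)
  where
  open ≡-Reasoning
  S : ℕ → ℕ
  S = sum ∘ applyUpTo (λ i → X ^ suc i)

m^[n*o]≡[m^o]^n : ∀ m n o → m ^ (n * o) ≡ (m ^ o) ^ n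
m^[n*o]≡[m^o]^n m n o = trans (cong (m ^_) (*-comm n o)) (sym (^-*-assoc m o n))

m≤o∸n⇒n≤o∸m : ∀ {m n o} → n ≤ o → m ≤ o ∸ n → n ≤ o ∸ m
m≤o∸n⇒n≤o∸m {m} {n} {o} n≤o m≤o∸n = m+n≤o⇒m≤o∸n n (subst (_≤ o) (+-comm m n) (m≤o∸n⇒m+n≤o m n≤o m≤o∸n))

least-witness : ∀ {ℓ} {P : ℕ → Set ℓ} → Decidable P → ∀ {n} → P n → ∃[ m ] P m × (∀ {j} → j < m → ¬ P j)
least-witness {P = P} P? {n} pn = search 0 n (λ ()) pn
  where
  search : ∀ k d → (∀ {j} → j < k → ¬ P j) → P (k + d) → ∃[ m ] P m × (∀ {j} → j < m → ¬ P j)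
  search k zero    below p = k , subst P (+-identityʳ k) p , below
  search k (suc d) below p with P? k
  ... | yes pk = k , pk , below
  ... | no ¬pk = search (suc k) d below′ (subst P (+-suc k d) p)
    where
    below′ : ∀ {j} → j < suc k → ¬ P j
    below′ j<1+k with m<1+n⇒m<n∨m≡n j<1+k
    ... | inj₁ j<k  = below j<k
    ... | inj₂ refl = ¬pk

count-multiples : ∀ o .{{_ : NonZero o}} q → sum (applyUpTo (λ t → 𝟙 (o ∣? t)) (q * o)) ≡ q
count-multiples o       zero    = refl
count-multiples o@(suc o′) (suc q) = begin
  sum (applyUpTo multiple? (o + q * o))
    ≡⟨ sum-applyUpTo-+ o (q * o) multiple? ⟩
  sum (applyUpTo multiple? o) + sum (applyUpTo (λ t → multiple? (o + t)) (q * o))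
    ≡⟨ cong₂ _+_ first-block (sum-applyUpTo-cong (q * o) (λ t _ → 𝟙-⇔ (o ∣? o + t) (o ∣? t)
                                (λ o∣o+t → ∣m+n∣m⇒∣n o∣o+t ∣-refl) (∣m∣n⇒∣m+n ∣-refl))) ⟩
  1 + sum (applyUpTo multiple? (q * o))
    ≡⟨ cong suc (count-multiples o q) ⟩
  suc q ∎
  where
  open ≡-Reasoning
  multiple? : ℕ → ℕ
  multiple? t = 𝟙 (o ∣? t)
  first-block : sum (applyUpTo multiple? o) ≡ 1
  first-block = cong₂ _+_ (𝟙-yes (o ∣? 0) (o ∣0))
    (sum-applyUpTo-zero o′ (λ t t<o′ → 𝟙-no (o ∣? suc t) (λ o∣1+t → <⇒≱ (s≤s t<o′) (∣⇒≤ o∣1+t))))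

module PrimePowers {p} (p-prime : Prime p) where

  instance
    p≢0 : NonZero p
    p≢0 = prime⇒nonZero p-prime

  p^n≡p^[n∸m]*p^m : ∀ {m n} → m ≤ n → p ^ n ≡ p ^ (n ∸ m) * p ^ m
  p^n≡p^[n∸m]*p^m {m} {n} m≤n = trans (cong (p ^_) (sym (m∸n+n≡m m≤n))) (^-distribˡ-+-* p (n ∸ m) m)

  p^m∣p^n : ∀ {m n} → m ≤ n → p ^ m ∣ p ^ n
  p^m∣p^n {m} {n} m≤n = divides (p ^ (n ∸ m)) (p^n≡p^[n∸m]*p^m m≤n)

  p^m∣p^n⇒m≤n : ∀ {m n} → p ^ m ∣ p ^ n → m ≤ n
  p^m∣p^n⇒m≤n {m} {n} p^m∣p^n with m ≤? n
  ... | yes m≤n = m≤n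
  ... | no  m≰n = contradiction (∣⇒≤ {{m^n≢0 p n}} p^m∣p^n) (<⇒≱ (^-monoʳ-< p 1<p (≰⇒> m≰n)))
    where
    1<p : 1 < p
    1<p = nonTrivial⇒n>1 p {{prime⇒nonTrivial p-prime}}

  ∣p^n⇒≡p^m : ∀ n {d} → d ∣ p ^ n → ∃[ m ] m ≤ n × d ≡ p ^ m
  ∣p^n⇒≡p^m zero    d∣1 = 0 , z≤n , ∣1⇒≡1 d∣1
  ∣p^n⇒≡p^m (suc n) {d} d∣p^[1+n] with p ∣? d
  ... | yes (divides q refl) with ∣p^n⇒≡p^m n {q} (*-cancelʳ-∣ p (subst (q * p ∣_) (*-comm p (p ^ n)) d∣p^[1+n]))
  ...   | m , m≤n , refl = suc m , s≤s m≤n , *-comm (p ^ m) p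
  ∣p^n⇒≡p^m (suc n) {d} d∣p^[1+n] | no p∤d with ∣p^n⇒≡p^m n (coprime-divisor d⊥p d∣p^[1+n])
    where
    d⊥p : Coprime d p
    d⊥p (x∣d , x∣p) with prime⇒irreducible p-prime x∣p
    ... | inj₁ x≡1 = x≡1
    ... | inj₂ refl = contradiction x∣d p∤d
  ... | m , m≤n , d≡p^m = m , m≤n⇒m≤1+n m≤n , d≡p^m

-- Homomorphisms from cyclic groups

toℕ-mod-% : ∀ m n → toℕ (m mod suc n) ≡ m % suc n
toℕ-mod-% m n = Fin.toℕ-fromℕ< _

toℕ-mod : ∀ {n} (a : Fin (suc n)) → toℕ a mod suc n ≡ a
toℕ-mod {n} a = Fin.toℕ-injective (trans (toℕ-mod-% (toℕ a) n) (m<n⇒m%n≡m (Fin.toℕ<n a)))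

mod-+ : ∀ {n} a b → (a + b) mod suc n ≡ addMod (suc n) (a mod suc n) (b mod suc n)
mod-+ {n} a b = Fin.toℕ-injective (begin
  toℕ ((a + b) mod suc n)                         ≡⟨ toℕ-mod-% (a + b) n ⟩
  (a + b) % suc n                                 ≡⟨ %-distribˡ-+ a b (suc n) ⟩
  (a % suc n + b % suc n) % suc n                 ≡⟨ cong₂ (λ u v → (u + v) % suc n) (toℕ-mod-% a n) (toℕ-mod-% b n) ⟨
  (toℕ (a mod suc n) + toℕ (b mod suc n)) % suc n ≡⟨ toℕ-mod-% (toℕ (a mod suc n) + toℕ (b mod suc n)) n ⟨
  toℕ (addMod (suc n) (a mod suc n) (b mod suc n)) ∎)
  where open ≡-Reasoning

mod-self : ∀ n → suc n mod suc n ≡ fzero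
mod-self n = Fin.toℕ-injective (trans (toℕ-mod-% (suc n) n) (n%n≡0 (suc n)))

abelianGroup : FinAbGroup → AbelianGroup 0ℓ 0ℓ
abelianGroup H = record { isAbelianGroup = FinAbGroup.isAbelianGroup H }

module _ (H : FinAbGroup) where
  open FinAbGroup H using (size)
  open AbelianGroup (abelianGroup H) using (_∙_; ε; monoid; group; identityʳ)
  open MonoidMult monoid using (×-homo-+; ×-homo-1; ×-assocˡ) renaming (_×_ to infix 7.5 _·_)
  open GroupProperties group using (identityˡ-unique)

  ·-ε : ∀ n → n · ε ≡ ε
  ·-ε zero    = refl
  ·-ε (suc n) = trans (cong (ε ∙_) (·-ε n)) (identityʳ ε)

  ·-multiple : ∀ {N h} → N · h ≡ ε → ∀ q → (q * N) · h ≡ ε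
  ·-multiple {N} {h} Nh≡ε q = begin
    (q * N) · h  ≡⟨ ×-assocˡ h q N ⟨
    q · (N · h)  ≡⟨ cong (q ·_) Nh≡ε ⟩
    q · ε        ≡⟨ ·-ε q ⟩
    ε            ∎
    where open ≡-Reasoning

  ·-mod : ∀ {N h} .{{_ : NonZero N}} → N · h ≡ ε → ∀ m → (m % N) · h ≡ m · h
  ·-mod {N} {h} Nh≡ε m = sym (begin
    m · h                              ≡⟨ cong (_· h) (m≡m%n+[m/n]*n m N) ⟩
    (m % N + (m / N) * N) · h          ≡⟨ ×-homo-+ h (m % N) _ ⟩
    (m % N) · h ∙ ((m / N) * N) · h    ≡⟨ cong ((m % N) · h ∙_) (·-multiple Nh≡ε (m / N)) ⟩
    (m % N) · h ∙ ε                    ≡⟨ identityʳ _ ⟩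
    (m % N) · h                        ∎)
    where open ≡-Reasoning

  ∃-order : ∀ {N h} → 0 < N → N · h ≡ ε → ∃[ o ] o · h ≡ ε × (∀ {t} → t · h ≡ ε → o ∣ t)
  ∃-order {h = h} 0<N Nh≡ε with least-witness (λ t → (0 <? t) ×-dec (t · h Fin.≟ ε)) (0<N , Nh≡ε)
  ... | zero    , (() , _) , _
  ... | suc o′ , (_ , oh≡ε) , minimal = suc o′ , oh≡ε , order∣
    where
    order∣ : ∀ {t} → t · h ≡ ε → suc o′ ∣ t
    order∣ {t} th≡ε with t % suc o′ in t%o≡r
    ... | zero  = m%n≡0⇒n∣m t (suc o′) t%o≡r
    ... | suc u = contradiction (s≤s z≤n , subst (λ r → r · h ≡ ε) t%o≡r (trans (·-mod oh≡ε t) th≡ε))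
                                (minimal (subst (_< suc o′) t%o≡r (m%n<n t (suc o′))))

  kernelSize : ∀ {m} → Vec (Fin size) m → ℕ
  kernelSize {m} φ = ∑[ a ∈ allFin m ] 𝟙 (lookup φ a Fin.≟ ε)

  annihilatorCount : ℕ → Fin size → ℕ
  annihilatorCount N h = sum (applyUpTo (λ t → 𝟙 (t · h Fin.≟ ε)) N)

  gamma≡sumOver-kernelSize : ∀ k m →
    gamma H k m ≡ ∑[ φ ∈ allVecs m size ] (𝟙 (isHom? H m φ) * kernelSize φ ^ k)
  gamma≡sumOver-kernelSize k m = begin
    ∑[ x ∈ allVecs k m ] length (filter (inKer? H m k x) (Homs H m))
      ≡⟨ sumOver-cong (allVecs k m) (λ x → trans (length-filter (inKer? H m k x) (Homs H m))
                                                 (sumOver-filter (isHom? H m) (allVecs m size) _)) ⟩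
    ∑[ x ∈ allVecs k m ] ∑[ φ ∈ allVecs m size ] (𝟙 (isHom? H m φ) * 𝟙 (inKer? H m k x φ))
      ≡⟨ sumOver-comm (allVecs k m) (allVecs m size) _ ⟩
    ∑[ φ ∈ allVecs m size ] ∑[ x ∈ allVecs k m ] (𝟙 (isHom? H m φ) * 𝟙 (inKer? H m k x φ))
      ≡⟨ sumOver-cong (allVecs m size) (λ φ → *-distribˡ-sumOver (𝟙 (isHom? H m φ)) (allVecs k m)
                                                                 (λ x → 𝟙 (inKer? H m k x φ))) ⟨
    ∑[ φ ∈ allVecs m size ] (𝟙 (isHom? H m φ) * ∑[ x ∈ allVecs k m ] 𝟙 (inKer? H m k x φ))
      ≡⟨ sumOver-cong (allVecs m size) (λ φ → cong (𝟙 (isHom? H m φ) *_)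
                                                   (sumOver-allVecs-all (λ a → lookup φ a Fin.≟ ε) k)) ⟩
    ∑[ φ ∈ allVecs m size ] (𝟙 (isHom? H m φ) * kernelSize φ ^ k) ∎
    where open ≡-Reasoning

  module Cyclic (n : ℕ) where

    generator-image : Vec (Fin size) (suc n) → Fin size
    generator-image φ = lookup φ (1 mod suc n)

    powers : Fin size → Vec (Fin size) (suc n)
    powers h = Vec.tabulate (λ a → toℕ a · h)

    lookup-powers : ∀ h a → lookup (powers h) a ≡ toℕ a · h
    lookup-powers h = lookup∘tabulate (λ a → toℕ a · h)

    module _ {φ : Vec (Fin size) (suc n)} (hom : IsHom H (suc n) φ) where

      hom-mod : ∀ t → lookup φ (t mod suc n) ≡ t · generator-image φ
      hom-mod zero    = identityˡ-unique (lookup φ fzero) _ (sym (hom fzero fzero))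
      hom-mod (suc t) = begin
        lookup φ ((1 + t) mod suc n)                                  ≡⟨ cong (lookup φ) (mod-+ 1 t) ⟩
        lookup φ (addMod (suc n) (1 mod suc n) (t mod suc n))         ≡⟨ hom _ _ ⟩
        generator-image φ ∙ lookup φ (t mod suc n)                    ≡⟨ cong (generator-image φ ∙_) (hom-mod t) ⟩
        generator-image φ ∙ t · generator-image φ                     ∎
        where open ≡-Reasoning

      hom-order : suc n · generator-image φ ≡ ε
      hom-order = trans (sym (hom-mod (suc n))) (trans (cong (lookup φ) (mod-self n)) (hom-mod 0))

      hom≡powers : φ ≡ powers (generator-image φ)
      hom≡powers = trans (sym (tabulate∘lookup φ))
        (tabulate-cong (λ a → trans (cong (lookup φ) (sym (toℕ-mod a))) (hom-mod (toℕ a))))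

    module _ {h : Fin size} (order : suc n · h ≡ ε) where

      powers-isHom : IsHom H (suc n) (powers h)
      powers-isHom a b = begin
        lookup (powers h) (addMod (suc n) a b)                 ≡⟨ lookup-powers h (addMod (suc n) a b) ⟩
        toℕ (addMod (suc n) a b) · h                           ≡⟨ cong (_· h) (toℕ-mod-% (toℕ a + toℕ b) n) ⟩
        ((toℕ a + toℕ b) % suc n) · h                          ≡⟨ ·-mod {suc n} order (toℕ a + toℕ b) ⟩
        (toℕ a + toℕ b) · h                                    ≡⟨ ×-homo-+ h (toℕ a) (toℕ b) ⟩
        toℕ a · h ∙ toℕ b · h                                  ≡⟨ cong₂ _∙_ (lookup-powers h a) (lookup-powers h b) ⟨
        lookup (powers h) a ∙ lookup (powers h) b              ∎
        where open ≡-Reasoning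

      generator-image-powers : generator-image (powers h) ≡ h
      generator-image-powers = begin
        lookup (powers h) (1 mod suc n)   ≡⟨ lookup-powers h (1 mod suc n) ⟩
        toℕ (1 mod suc n) · h             ≡⟨ cong (_· h) (toℕ-mod-% 1 n) ⟩
        (1 % suc n) · h                   ≡⟨ ·-mod {suc n} order 1 ⟩
        1 · h                             ≡⟨ ×-homo-1 h ⟩
        h                                 ∎
        where open ≡-Reasoning

    homs↔annihilated : PartialInverse (IsHom H (suc n)) (λ h → suc n · h ≡ ε)
    homs↔annihilated = record
      { to          = generator-image
      ; from        = powers
      ; to-closed   = λ {φ} → hom-order {φ}
      ; from-closed = λ {h} → powers-isHom {h}
      ; from∘to     = λ {φ} hom → sym (hom≡powers {φ} hom)
      ; to∘from     = λ {h} → generator-image-powers {h}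
      }

    kernelSize-powers : ∀ h → kernelSize (powers h) ≡ annihilatorCount (suc n) h
    kernelSize-powers h =
      trans (sumOver-cong (allFin (suc n)) (λ a → cong (λ z → 𝟙 (z Fin.≟ ε)) (lookup-powers h a)))
            (sumOver-allFin-toℕ (suc n) (λ t → 𝟙 (t · h Fin.≟ ε)))

    sumOver-homs : ∀ w → ∑[ φ ∈ allVecs (suc n) size ] (𝟙 (isHom? H (suc n) φ) * w φ)
                       ≡ ∑[ h ∈ allFin size ] (𝟙 (suc n · h Fin.≟ ε) * w (powers h))
    sumOver-homs = sumOver-reindex (allVecs-enumerates (suc n) size) (allFin-enumerates size)
                     (isHom? H (suc n)) (λ h → suc n · h Fin.≟ ε) homs↔annihilated

  homCount≡sumOver-annihilated : ∀ N .{{_ : NonZero N}} → homCount H N ≡ ∑[ h ∈ allFin size ] 𝟙 (N · h Fin.≟ ε)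
  homCount≡sumOver-annihilated (suc n) = begin
    length (filter (isHom? H (suc n)) (allVecs (suc n) size))
      ≡⟨ length-filter (isHom? H (suc n)) (allVecs (suc n) size) ⟩
    ∑[ φ ∈ allVecs (suc n) size ] 𝟙 (isHom? H (suc n) φ)
      ≡⟨ sumOver-cong (allVecs (suc n) size) (λ φ → *-identityʳ _) ⟨
    ∑[ φ ∈ allVecs (suc n) size ] (𝟙 (isHom? H (suc n) φ) * 1)
      ≡⟨ sumOver-homs (λ _ → 1) ⟩
    ∑[ h ∈ allFin size ] (𝟙 (suc n · h Fin.≟ ε) * 1)
      ≡⟨ sumOver-cong (allFin size) (λ h → *-identityʳ _) ⟩
    ∑[ h ∈ allFin size ] 𝟙 (suc n · h Fin.≟ ε) ∎
    where
    open ≡-Reasoning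
    open Cyclic n

  gamma≡sumOver-annihilated : ∀ k N .{{_ : NonZero N}} →
    gamma H k N ≡ ∑[ h ∈ allFin size ] (𝟙 (N · h Fin.≟ ε) * annihilatorCount N h ^ k)
  gamma≡sumOver-annihilated k (suc n) = begin
    gamma H k (suc n)
      ≡⟨ gamma≡sumOver-kernelSize k (suc n) ⟩
    ∑[ φ ∈ allVecs (suc n) size ] (𝟙 (isHom? H (suc n) φ) * kernelSize φ ^ k)
      ≡⟨ sumOver-homs (λ φ → kernelSize φ ^ k) ⟩
    ∑[ h ∈ allFin size ] (𝟙 (suc n · h Fin.≟ ε) * kernelSize (powers h) ^ k)
      ≡⟨ sumOver-cong (allFin size) (λ h → cong (λ z → 𝟙 (suc n · h Fin.≟ ε) * z ^ k) (kernelSize-powers h)) ⟩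
    ∑[ h ∈ allFin size ] (𝟙 (suc n · h Fin.≟ ε) * annihilatorCount (suc n) h ^ k) ∎
    where
    open ≡-Reasoning
    open Cyclic n

  module _ {p} (p-prime : Prime p) where
    open PrimePowers p-prime

    annihilated-upward : ∀ {j r h} → j ≤ r → p ^ j · h ≡ ε → p ^ r · h ≡ ε
    annihilated-upward {j} {r} {h} j≤r p^jh≡ε =
      subst (λ z → z · h ≡ ε) (sym (p^n≡p^[n∸m]*p^m j≤r)) (·-multiple p^jh≡ε (p ^ (r ∸ j)))

    prime-power-order : ∀ {r h} → p ^ r · h ≡ ε →
                        ∃[ c ] c ≤ r × p ^ c · h ≡ ε × (∀ {t} → t · h ≡ ε → p ^ c ∣ t)
    prime-power-order {r} p^rh≡ε with ∃-order (m^n>0 p r) p^rh≡ε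
    ... | o , oh≡ε , order∣ with ∣p^n⇒≡p^m r (order∣ p^rh≡ε)
    ...   | c , c≤r , refl = c , c≤r , oh≡ε , order∣

    module _ {h c} (p^ch≡ε : p ^ c · h ≡ ε) (order∣ : ∀ {t} → t · h ≡ ε → p ^ c ∣ t) where

      𝟙-annihilated : ∀ t → 𝟙 (t · h Fin.≟ ε) ≡ 𝟙 (p ^ c ∣? t)
      𝟙-annihilated t = 𝟙-⇔ (t · h Fin.≟ ε) (p ^ c ∣? t) order∣
        (λ { (divides q refl) → ·-multiple p^ch≡ε q })

      𝟙-p^j-annihilated : ∀ j → 𝟙 (p ^ j · h Fin.≟ ε) ≡ 𝟙 (c ≤? j)
      𝟙-p^j-annihilated j = trans (𝟙-annihilated (p ^ j))
        (𝟙-⇔ (p ^ c ∣? p ^ j) (c ≤? j) p^m∣p^n⇒m≤n p^m∣p^n)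

      annihilatorCount-p^r : ∀ {r} → c ≤ r → annihilatorCount (p ^ r) h ≡ p ^ (r ∸ c)
      annihilatorCount-p^r {r} c≤r = begin
        sum (applyUpTo (λ t → 𝟙 (t · h Fin.≟ ε)) (p ^ r))
          ≡⟨ sum-applyUpTo-cong (p ^ r) (λ t _ → 𝟙-annihilated t) ⟩
        sum (applyUpTo (λ t → 𝟙 (p ^ c ∣? t)) (p ^ r))
          ≡⟨ cong (sum ∘ applyUpTo (λ t → 𝟙 (p ^ c ∣? t))) (p^n≡p^[n∸m]*p^m c≤r) ⟩
        sum (applyUpTo (λ t → 𝟙 (p ^ c ∣? t)) (p ^ (r ∸ c) * p ^ c))
          ≡⟨ count-multiples (p ^ c) {{m^n≢0 p c}} (p ^ (r ∸ c)) ⟩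
        p ^ (r ∸ c) ∎
        where open ≡-Reasoning

      sum-annihilated-p^[r∸1+i] : ∀ {r} k → c ≤ r →
        sum (applyUpTo (λ i → p ^ (suc i * k) * 𝟙 (p ^ (r ∸ suc i) · h Fin.≟ ε)) r)
          ≡ sum (applyUpTo (λ i → (p ^ k) ^ suc i) (r ∸ c))
      sum-annihilated-p^[r∸1+i] {r} k c≤r = trans
        (sum-applyUpTo-cong r (λ i i<r → cong₂ _*_ (m^[n*o]≡[m^o]^n p (suc i) k) (present i i<r)))
        (sum-applyUpTo-restrict (m∸n≤m r c) (λ i → (p ^ k) ^ suc i))
        where
        present : ∀ i → i < r → 𝟙 (p ^ (r ∸ suc i) · h Fin.≟ ε) ≡ 𝟙 (i <? r ∸ c)
        present i i<r = trans (𝟙-p^j-annihilated (r ∸ suc i))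
          (𝟙-⇔ (c ≤? r ∸ suc i) (i <? r ∸ c) (m≤o∸n⇒n≤o∸m i<r) (m≤o∸n⇒n≤o∸m c≤r))

    pointwise-formula : ∀ r k h →
      p ^ k * (𝟙 (p ^ r · h Fin.≟ ε) * annihilatorCount (p ^ r) h ^ k)
        ≡ p ^ k * 𝟙 (p ^ r · h Fin.≟ ε)
          + (p ^ k ∸ 1) * sum (applyUpTo (λ i → p ^ (suc i * k) * 𝟙 (p ^ (r ∸ suc i) · h Fin.≟ ε)) r)
    pointwise-formula r k h with p ^ r · h Fin.≟ ε
    ... | no p^rh≢ε = sym (begin
      X * 0 + (X ∸ 1) * sum (applyUpTo term r)   ≡⟨ cong (λ z → X * 0 + (X ∸ 1) * z) (sum-applyUpTo-zero r vanishes) ⟩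
      X * 0 + (X ∸ 1) * 0                        ≡⟨ cong (X * 0 +_) (*-zeroʳ (X ∸ 1)) ⟩
      X * 0 + 0                                  ≡⟨ +-identityʳ (X * 0) ⟩
      X * 0                                      ∎)
      where
      open ≡-Reasoning
      X = p ^ k
      term : ℕ → ℕ
      term i = p ^ (suc i * k) * 𝟙 (p ^ (r ∸ suc i) · h Fin.≟ ε)
      vanishes : ∀ i → i < r → term i ≡ 0
      vanishes i _ = trans (cong (p ^ (suc i * k) *_) (𝟙-no (p ^ (r ∸ suc i) · h Fin.≟ ε)
                                   (p^rh≢ε ∘ annihilated-upward (m∸n≤m r (suc i)))))
                           (*-zeroʳ (p ^ (suc i * k)))
    ... | yes p^rh≡ε with prime-power-order p^rh≡ε
    ...   | c , c≤r , p^ch≡ε , order∣ = begin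
      X * (1 * annihilatorCount (p ^ r) h ^ k)
        ≡⟨ cong (X *_) (trans (*-identityˡ _) (cong (_^ k) (annihilatorCount-p^r p^ch≡ε order∣ c≤r))) ⟩
      X * (p ^ (r ∸ c)) ^ k
        ≡⟨ cong (X *_) (trans (^-*-assoc p (r ∸ c) k) (m^[n*o]≡[m^o]^n p (r ∸ c) k)) ⟩
      X * X ^ (r ∸ c)
        ≡⟨ geometric-sum (m^n>0 p k) (r ∸ c) ⟩
      X + (X ∸ 1) * sum (applyUpTo (λ i → X ^ suc i) (r ∸ c))
        ≡⟨ cong₂ (λ u v → u + (X ∸ 1) * v) (*-identityʳ X) (sum-annihilated-p^[r∸1+i] p^ch≡ε order∣ k c≤r) ⟨
      X * 1 + (X ∸ 1) * sum (applyUpTo (λ i → p ^ (suc i * k) * 𝟙 (p ^ (r ∸ suc i) · h Fin.≟ ε)) r) ∎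
      where
      open ≡-Reasoning
      X = p ^ k

lemma3p2 : (p r k : ℕ) → Prime p → 1 ≤ r → 1 ≤ k → (H : FinAbGroup) →
    p ^ k * gamma H k (p ^ r)
      ≡ p ^ k * homCount H (p ^ r)
        + (p ^ k ∸ 1) * sum (applyUpTo (λ i → p ^ (suc i * k) * homCount H (p ^ (r ∸ suc i))) r)
lemma3p2 p r k p-prime _ _ H = begin
  X * gamma H k (p ^ r)
    ≡⟨ cong (X *_) (gamma≡sumOver-annihilated H k (p ^ r) {{m^n≢0 p r}}) ⟩
  X * ∑[ h ∈ allFin size ] (𝟙 (p ^ r · h Fin.≟ ε) * annihilatorCount H (p ^ r) h ^ k)
    ≡⟨ *-distribˡ-sumOver X (allFin size) _ ⟩
  ∑[ h ∈ allFin size ] (X * (𝟙 (p ^ r · h Fin.≟ ε) * annihilatorCount H (p ^ r) h ^ k))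
    ≡⟨ sumOver-cong (allFin size) (pointwise-formula H p-prime r k) ⟩
  ∑[ h ∈ allFin size ] (X * 𝟙 (p ^ r · h Fin.≟ ε)
                        + (X ∸ 1) * sum (applyUpTo (λ i → A i * annihilated? i h) r))
    ≡⟨ sumOver-affine (allFin size) X (X ∸ 1) _ r (λ i h → A i * annihilated? i h) ⟩
  X * ∑[ h ∈ allFin size ] 𝟙 (p ^ r · h Fin.≟ ε)
    + (X ∸ 1) * sum (applyUpTo (λ i → ∑[ h ∈ allFin size ] (A i * annihilated? i h)) r)
    ≡⟨ cong₂ (λ u v → X * u + (X ∸ 1) * v) (homCount≡ r) (sum-applyUpTo-cong r (λ i _ → A-homCount≡ i)) ⟨
  X * homCount H (p ^ r) + (X ∸ 1) * sum (applyUpTo (λ i → A i * homCount H (p ^ (r ∸ suc i))) r) ∎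
  where
  open ≡-Reasoning
  open PrimePowers p-prime using (p≢0)
  open FinAbGroup H using (size)
  open AbelianGroup (abelianGroup H) using (ε; monoid)
  open MonoidMult monoid using () renaming (_×_ to infix 7.5 _·_)
  X = p ^ k
  A = λ i → p ^ (suc i * k)
  annihilated? : ℕ → Fin size → ℕ
  annihilated? i h = 𝟙 (p ^ (r ∸ suc i) · h Fin.≟ ε)
  homCount≡ : ∀ j → homCount H (p ^ j) ≡ ∑[ h ∈ allFin size ] 𝟙 (p ^ j · h Fin.≟ ε)
  homCount≡ j = homCount≡sumOver-annihilated H (p ^ j) {{m^n≢0 p j}}
  A-homCount≡ : ∀ i → A i * homCount H (p ^ (r ∸ suc i)) ≡ ∑[ h ∈ allFin size ] (A i * annihilated? i h)
  A-homCount≡ i = trans (cong (A i *_) (homCount≡ (r ∸ suc i))) (*-distribˡ-sumOver (A i) (allFin size) _)
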